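{- Let $D$ be a finite digraph. Any two distinct coresets of $D$ are disjoint.
   Context: Digraphs are finite; loops are allowed, multiple edges are not. An edge from $u$ to $v$ is written $uv$, with tail $u$ and head $v$. A sink is a vertex with no successors; a source is a vertex with no predecessors (a vertex with a loop is neither). For a vertex $v$, $\alpha(v)$ is the set of successors (out-neighbors) of $v$ and $\beta(v)$ the set of predecessors (in-neighbors). For a nonempty set $S\subseteq V(D)$, $\alpha(S)=\bigcup_{v\in S}\alpha(v)$ and $\beta(S)=\bigcup_{v\in S}\beta(v)$; by convention $\alpha(\emptyset)$ is the set of sources and $\beta(\emptyset)$ is the set of sinks. A coreset of $D$ is either (1) the set of all sinks of $D$ (the trivial coreset; it may be empty), or (2) a minimal nonempty set $U\subseteq V(D)$ such that $\beta(\alpha(U))=U$ (a nontrivial coreset). -}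

module Defs where

open import Data.Nat using (ℕ; zero; suc)
open import Data.Bool using (Bool; true; false; _∧_; _∨_; not; if_then_else_)
open import Data.Fin using (Fin; zero; suc)
open import Data.Vec using (tabulate; lookup)
open import Data.Fin.Subset using (Subset; _∈_; _⊆_; Nonempty)
open import Data.Product using (_×_)
open import Data.Sum using (_⊎_)
open import Relation.Binary.PropositionalEquality using (_≡_)

-- A finite digraph on vertex set Fin n, given by its adjacency relation:
-- E u v ≡ true  iff  uv is an edge.  Loops allowed, no multiple edges.
Digraph : ℕ → Set
Digraph n = Fin n → Fin n → Bool

anyFin : ∀ {n} → (Fin n → Bool) → Bool
anyFin {zero}  f = false
anyFin {suc n} f = f zero ∨ anyFin (λ i → f (suc i))

module _ {n : ℕ} (D : Digraph n) where

  isSink : Fin n → Bool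
  isSink v = not (anyFin (λ w → D v w))

  isSource : Fin n → Bool
  isSource v = not (anyFin (λ u → D u v))

  isEmptySet : Subset n → Bool
  isEmptySet S = not (anyFin (λ v → lookup S v))

  sinks : Subset n
  sinks = tabulate isSink

  α : Subset n → Subset n
  α S = tabulate (λ x → if isEmptySet S then isSource x
                        else anyFin (λ v → lookup S v ∧ D v x))

  β : Subset n → Subset n
  β S = tabulate (λ x → if isEmptySet S then isSink x
                        else anyFin (λ v → lookup S v ∧ D x v))

  IsNontrivialCoreset : Subset n → Set
  IsNontrivialCoreset U =
    Nonempty U × β (α U) ≡ U ×
    (∀ W → Nonempty W → β (α W) ≡ W → W ⊆ U → W ≡ U)

  IsCoreset : Subset n → Set
  IsCoreset U = U ≡ sinks ⊎ IsNontrivialCoreset U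

{-# OPTIONS --safe #-}
module Submission where

-- A fixed point U = β(α U) is the set of sinks when α U = ∅; otherwise every vertex of U has a
-- successor in α U, so U contains no sink.  If two such sink-free fixed points U, W meet, their
-- intersection Z is nonempty and sink-free, hence Z ⊆ β(α Z), while monotonicity of β ∘ α on
-- nonempty sets gives β(α Z) ⊆ β(α U) ∩ β(α W) = Z.  So Z is a fixed point and minimality
-- forces U = Z = W.

open import Defs
open import Data.Nat using (ℕ; suc)
open import Data.Bool using (Bool; true; false; _∧_; not)
open import Data.Fin using (Fin; zero; suc)
open import Data.Fin.Subset using (Subset; _∈_; _⊆_; _∩_; Nonempty)
open import Data.Fin.Subset.Properties using (nonempty?; ⊆-antisym; p∩q⊆p; p∩q⊆q; x∈p∩q⁺)
open import Data.Vec using (lookup)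
open import Data.Vec.Properties using (lookup∘tabulate; []=⇒lookup; lookup⇒[]=)
open import Data.Empty using (⊥)
open import Data.Product using (∃; ∃-syntax; _×_; _,_)
open import Data.Sum using (_⊎_; inj₁; inj₂)
open import Function using (flip)
open import Relation.Nullary using (¬_; yes; no; contradiction)
open import Relation.Binary.PropositionalEquality using (_≡_; _≢_; refl; sym; trans; cong; subst)

∧-≡-true⁺ : ∀ {a b} → a ≡ true → b ≡ true → a ∧ b ≡ true
∧-≡-true⁺ refl refl = refl

∧-≡-true⁻ : ∀ a {b} → a ∧ b ≡ true → a ≡ true × b ≡ true
∧-≡-true⁻ true refl = refl , refl

anyFin⁺ : ∀ {n} (f : Fin n → Bool) i → f i ≡ true → anyFin f ≡ true
anyFin⁺ f zero    fi≡true with f zero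
... | true = refl
anyFin⁺ f (suc i) fi≡true with f zero
... | true  = refl
... | false = anyFin⁺ (λ j → f (suc j)) i fi≡true

anyFin⁻ : ∀ {n} (f : Fin n → Bool) → anyFin f ≡ true → ∃ λ i → f i ≡ true
anyFin⁻ {suc n} f any≡true with f zero in f0≡
... | true  = zero , f0≡
... | false with anyFin⁻ (λ j → f (suc j)) any≡true
...   | i , fi≡true = suc i , fi≡true

module _ {n : ℕ} (D : Digraph n) where

  isEmptySet-nonempty : ∀ {S} → Nonempty S → isEmptySet D S ≡ false
  isEmptySet-nonempty {S} (v , v∈S) = cong not (anyFin⁺ (lookup S) v ([]=⇒lookup v∈S))

  isEmptySet-empty : ∀ {S} → ¬ Nonempty S → isEmptySet D S ≡ true
  isEmptySet-empty {S} S-empty with anyFin (lookup S) in any≡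
  ... | false = refl
  ... | true  with anyFin⁻ (lookup S) any≡
  ...   | v , Sv≡true = contradiction (v , lookup⇒[]= v S Sv≡true) S-empty

  lookup-β : ∀ {S} → Nonempty S → ∀ y → lookup (β D S) y ≡ anyFin (λ v → lookup S v ∧ D y v)
  lookup-β {S} S≠∅ y with isEmptySet D S | isEmptySet-nonempty S≠∅
  ... | false | refl = lookup∘tabulate _ y

  ∈β⁺ : ∀ {S v y} → Nonempty S → v ∈ S → D y v ≡ true → y ∈ β D S
  ∈β⁺ {S} {v} {y} S≠∅ v∈S Dyv =
    lookup⇒[]= y (β D S) (trans (lookup-β S≠∅ y) (anyFin⁺ _ v (∧-≡-true⁺ ([]=⇒lookup v∈S) Dyv)))

  ∈β⁻ : ∀ {S y} → Nonempty S → y ∈ β D S → ∃[ v ] v ∈ S × D y v ≡ true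
  ∈β⁻ {S} {y} S≠∅ y∈βS with anyFin⁻ _ (trans (sym (lookup-β S≠∅ y)) ([]=⇒lookup y∈βS))
  ... | v , Sv∧Dyv with ∧-≡-true⁻ (lookup S v) Sv∧Dyv
  ...   | Sv≡true , Dyv = v , lookup⇒[]= v S Sv≡true , Dyv

  β-mono : ∀ {S T} → Nonempty S → S ⊆ T → β D S ⊆ β D T
  β-mono S≠∅ S⊆T y∈βS with ∈β⁻ S≠∅ y∈βS
  ... | v , v∈S , Dyv = ∈β⁺ (v , S⊆T v∈S) (S⊆T v∈S) Dyv

  β-empty : ∀ {S} → ¬ Nonempty S → β D S ≡ sinks D
  β-empty {S} S-empty with isEmptySet D S | isEmptySet-empty S-empty
  ... | true | refl = refl

  HasSuccessor : Fin n → Set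
  HasSuccessor v = ∃[ w ] D v w ≡ true

  SinkFree : Subset n → Set
  SinkFree S = ∀ {v} → v ∈ S → HasSuccessor v

  sink-no-successor : ∀ {v} → v ∈ sinks D → ¬ HasSuccessor v
  sink-no-successor {v} v∈sinks (w , Dvw) =
    contradiction (trans (sym isSink-v) (cong not (anyFin⁺ (D v) w Dvw))) λ ()
    where
    isSink-v : isSink D v ≡ true
    isSink-v = trans (sym (lookup∘tabulate (isSink D) v)) ([]=⇒lookup v∈sinks)

-- α D is, definitionally, β of the reversed digraph (α ∅ = sources = sinks of the reverse).
module _ {n : ℕ} (D : Digraph n) where

  ∈α⁺ : ∀ {S v x} → Nonempty S → v ∈ S → D v x ≡ true → x ∈ α D S
  ∈α⁺ = ∈β⁺ (flip D)

  α-mono : ∀ {S T} → Nonempty S → S ⊆ T → α D S ⊆ α D T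
  α-mono = β-mono (flip D)

  α-nonempty : ∀ {S} → Nonempty S → SinkFree D S → Nonempty (α D S)
  α-nonempty S≠∅@(v , v∈S) S-sinkFree with S-sinkFree v∈S
  ... | w , Dvw = w , ∈α⁺ S≠∅ v∈S Dvw

  βα-mono : ∀ {S T} → Nonempty S → SinkFree D S → S ⊆ T → β D (α D S) ⊆ β D (α D T)
  βα-mono S≠∅ S-sinkFree S⊆T = β-mono D (α-nonempty S≠∅ S-sinkFree) (α-mono S≠∅ S⊆T)

  ⊆-βα : ∀ {S} → Nonempty S → SinkFree D S → S ⊆ β D (α D S)
  ⊆-βα S≠∅ S-sinkFree v∈S with S-sinkFree v∈S
  ... | w , Dvw = ∈β⁺ D (α-nonempty S≠∅ S-sinkFree) (∈α⁺ S≠∅ v∈S Dvw) Dvw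

  βα-fixed-dichotomy : ∀ {U} → β D (α D U) ≡ U → U ≡ sinks D ⊎ SinkFree D U
  βα-fixed-dichotomy {U} U-fixed with nonempty? (α D U)
  ... | no αU-empty = inj₁ (trans (sym U-fixed) (β-empty D αU-empty))
  ... | yes αU≠∅   = inj₂ λ u∈U → successor (∈β⁻ D αU≠∅ (subst (_ ∈_) (sym U-fixed) u∈U))
    where
    successor : ∀ {u} → ∃[ w ] w ∈ α D U × D u w ≡ true → HasSuccessor D u
    successor (w , _ , Duw) = w , Duw

  coreset-dichotomy : ∀ {U} → IsCoreset D U → U ≡ sinks D ⊎ (IsNontrivialCoreset D U × SinkFree D U)
  coreset-dichotomy (inj₁ U≡sinks) = inj₁ U≡sinks
  coreset-dichotomy (inj₂ U-core@(_ , U-fixed , _)) with βα-fixed-dichotomy U-fixed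
  ... | inj₁ U≡sinks   = inj₁ U≡sinks
  ... | inj₂ U-sinkFree = inj₂ (U-core , U-sinkFree)

  βα-fixed-∩ : ∀ {U W} → β D (α D U) ≡ U → β D (α D W) ≡ W → SinkFree D U →
               Nonempty (U ∩ W) → β D (α D (U ∩ W)) ≡ U ∩ W
  βα-fixed-∩ {U} {W} U-fixed W-fixed U-sinkFree U∩W≠∅ = ⊆-antisym βα⊆∩ (⊆-βα U∩W≠∅ ∩-sinkFree)
    where
    ∩-sinkFree : SinkFree D (U ∩ W)
    ∩-sinkFree v∈U∩W = U-sinkFree (p∩q⊆p U W v∈U∩W)

    βα⊆ : ∀ {V} → β D (α D V) ≡ V → U ∩ W ⊆ V → β D (α D (U ∩ W)) ⊆ V
    βα⊆ V-fixed U∩W⊆V y∈ = subst (_ ∈_) V-fixed (βα-mono U∩W≠∅ ∩-sinkFree U∩W⊆V y∈)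

    βα⊆∩ : β D (α D (U ∩ W)) ⊆ U ∩ W
    βα⊆∩ y∈ = x∈p∩q⁺ (βα⊆ U-fixed (p∩q⊆p U W) y∈ , βα⊆ W-fixed (p∩q⊆q U W) y∈)

  meeting-nontrivial-coresets-≡ : ∀ {U W} → IsNontrivialCoreset D U → IsNontrivialCoreset D W →
                                  SinkFree D U → Nonempty (U ∩ W) → U ≡ W
  meeting-nontrivial-coresets-≡ {U} {W} (_ , U-fixed , U-minimal) (_ , W-fixed , W-minimal) U-sinkFree U∩W≠∅ =
    trans (sym (U-minimal (U ∩ W) U∩W≠∅ ∩-fixed (p∩q⊆p U W)))
          (W-minimal (U ∩ W) U∩W≠∅ ∩-fixed (p∩q⊆q U W))
    where
    ∩-fixed : β D (α D (U ∩ W)) ≡ U ∩ W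
    ∩-fixed = βα-fixed-∩ U-fixed W-fixed U-sinkFree U∩W≠∅

lemma1 : (n : ℕ) (D : Digraph n) (U W : Subset n) →
         IsCoreset D U → IsCoreset D W → U ≢ W →
         (x : Fin n) → x ∈ U → x ∈ W → ⊥
lemma1 n D U W U-coreset W-coreset U≢W x x∈U x∈W
  with coreset-dichotomy D U-coreset | coreset-dichotomy D W-coreset
... | inj₁ U≡sinks | inj₁ W≡sinks =
  U≢W (trans U≡sinks (sym W≡sinks))
... | inj₁ U≡sinks | inj₂ (_ , W-sinkFree) =
  sink-no-successor D (subst (x ∈_) U≡sinks x∈U) (W-sinkFree x∈W)
... | inj₂ (_ , U-sinkFree) | inj₁ W≡sinks =
  sink-no-successor D (subst (x ∈_) W≡sinks x∈W) (U-sinkFree x∈U)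
... | inj₂ (U-nontrivial , U-sinkFree) | inj₂ (W-nontrivial , _) =
  U≢W (meeting-nontrivial-coresets-≡ D U-nontrivial W-nontrivial U-sinkFree (x , x∈p∩q⁺ (x∈U , x∈W)))
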